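{- For every $n$-vertex graph $G$ and every nonnegative integer $k$ such that $k < \mu(G)$, we have $$\frac{m(K_n,k)}{m(K_n,k+1)}\leq \frac{m(G,k)}{m(G,k+1)}.$$
   Context: A matching of a graph is a set of pairwise vertex-disjoint edges; $m(G,k)$ denotes the number of matchings of cardinality $k$ in $G$, and $\mu(G)$ the matching number (maximum cardinality of a matching) of $G$. $K_n$ is the complete graph on $n$ vertices. -}

module Defs where

open import Data.Nat using (ℕ; zero; suc; _+_; _*_; _≤_; _<_; _<ᵇ_; _⊔_)
open import Data.Bool using (Bool; true; false; _∧_; not; if_then_else_)
open import Data.Fin using (Fin; toℕ)
open import Data.Fin.Properties using () renaming (_≟_ to _≟ᶠ_)
open import Data.List using (List; []; _∷_; length; filter; concatMap; allFin; map; upTo)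
open import Data.Product using (_×_; _,_; proj₁; proj₂)
open import Relation.Nullary.Decidable using (⌊_⌋)
open import Relation.Binary.PropositionalEquality using (_≡_)

record Graph (n : ℕ) : Set where
  field
    adj    : Fin n → Fin n → Bool
    adj-sym    : ∀ i j → adj i j ≡ adj j i
    adj-irrefl : ∀ i → adj i i ≡ false
open Graph public

K : (n : ℕ) → Graph n
K n = record { adj = λ i j → not ⌊ i ≟ᶠ j ⌋ ; adj-sym = s ; adj-irrefl = r }
  where
  open import Relation.Binary.PropositionalEquality using (refl)
  open import Relation.Nullary using (yes; no)
  open import Relation.Binary.PropositionalEquality using () renaming (sym to ≡sym)
  s : ∀ i j → not ⌊ i ≟ᶠ j ⌋ ≡ not ⌊ j ≟ᶠ i ⌋
  s i j with i ≟ᶠ j | j ≟ᶠ i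
  ... | yes _ | yes _ = refl
  ... | no _  | no _  = refl
  ... | yes p | no q  = Data.Empty.⊥-elim (q (≡sym p)) where import Data.Empty
  ... | no p  | yes q = Data.Empty.⊥-elim (p (≡sym q)) where import Data.Empty
  r : ∀ i → not ⌊ i ≟ᶠ i ⌋ ≡ false
  r i with i ≟ᶠ i
  ... | yes _ = refl
  ... | no ¬p = Data.Empty.⊥-elim (¬p refl) where import Data.Empty

Edge : ℕ → Set
Edge n = Fin n × Fin n

-- Edge list of G: each edge {i,j} listed once, as (i , j) with i < j.
edges : ∀ {n} → Graph n → List (Edge n)
edges {n} G = concatMap (λ i → map (λ j → (i , j))
                  (filter (λ j → toℕ i Data.Nat.<? toℕ j) (allFin n))) (allFin n)
  where import Data.Nat

choose : ∀ {A : Set} → ℕ → List A → List (List A)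
choose zero    _        = [] ∷ []
choose (suc k) []       = []
choose (suc k) (x ∷ xs) = map (x ∷_) (choose k xs) Data.List.++ choose (suc k) xs
  where import Data.List

adjE : ∀ {n} → Graph n → Edge n → Bool
adjE G (i , j) = adj G i j

eqF : ∀ {n} → Fin n → Fin n → Bool
eqF i j = ⌊ i ≟ᶠ j ⌋

disjointE : ∀ {n} → Edge n → Edge n → Bool
disjointE (a , b) (c , d) =
  not (eqF a c) ∧ not (eqF a d) ∧ not (eqF b c) ∧ not (eqF b d)

allB : ∀ {A : Set} → (A → Bool) → List A → Bool
allB p []       = true
allB p (x ∷ xs) = p x ∧ allB p xs

-- A set of distinct edges is a matching iff its edges are pairwise vertex-disjoint.
pairwiseDisjoint : ∀ {n} → List (Edge n) → Bool
pairwiseDisjoint []       = true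
pairwiseDisjoint (e ∷ es) = allB (disjointE e) es ∧ pairwiseDisjoint es

m : ∀ {n} → Graph n → ℕ → ℕ
m G k = length (filter (λ M → Data.Bool.T? (pairwiseDisjoint M))
                       (choose k (edgesOf G)))
  where
  import Data.Bool
  edgesOf : _ → _
  edgesOf G = filter (λ e → Data.Bool.T? (adjE G e)) (edges G)

-- μ(G): matching number = largest k with m(G,k) > 0 (k ranges over 0..n,
-- which suffices since a matching has at most n/2 edges).
μ : ∀ {n} → Graph n → ℕ
μ {n} G = go (suc n)
  where
  go : ℕ → ℕ
  go zero    = 0
  go (suc k) = if 0 <ᵇ m G k then k ⊔ go k else go k

module Submission where

-- Double counting.  Let c = C(n − 2k, 2).  Summing, over the k-matchings M of G, the number of
-- edges of G disjoint from M counts every (k+1)-matching exactly k+1 times, so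
-- (k+1) m(G,k+1) = Σ_M #{e ∈ E(G) : e disjoint from M}.  An edge disjoint from M joins two of
-- the n − 2k vertices left uncovered by M, so each summand is at most c, with equality for K_n:
-- (k+1) m(G,k+1) ≤ c m(G,k) and (k+1) m(K_n,k+1) = c m(K_n,k).  Cross-multiplying gives the claim.

open import Defs
open import Algebra.Bundles using (CommutativeMonoid)
import Algebra.Properties.CommutativeSemigroup as CommutativeSemigroupProperties
open import Data.Bool using (Bool; true; false; _∧_; not; T; T?)
open import Data.Bool.Properties using (∧-assoc; ∧-comm; ∧-commutativeMonoid; T-∧)
open import Data.Fin using (Fin; toℕ) renaming (zero to fzero; suc to fsuc)
open import Data.Fin.Properties using () renaming (_≟_ to _≟ᶠ_)
open import Data.List using (List; []; _∷_; length; map; _++_; filter; filterᵇ; concatMap; allFin; tabulate)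
open import Data.List.Properties
  using (length-++; length-map; map-++; map-∘; map-cong; filter-++; length-filter; filter-reject; filter-all; filter-none)
open import Data.List.Relation.Unary.All using (All; []; _∷_)
import Data.List.Relation.Unary.All as All
import Data.List.Relation.Unary.All.Properties as AllP
open import Data.Nat using (ℕ; zero; suc; _+_; _*_; _∸_; _≤_; _<_; z≤n; _<?_; _<ᵇ_)
open import Data.Nat.Combinatorics using (_C_; nC1≡n; nCk+nC[k+1]≡[n+1]C[k+1])
open import Data.Nat.ListAction using (sum)
open import Data.Nat.ListAction.Properties using (sum-++)
open import Data.Nat.Properties
open import Data.Nat.Tactic.RingSolver using (solve-∀)
open import Data.Product using (_×_; _,_; proj₁; proj₂; uncurry)
open import Function using (_∘_; id; Equivalence)
open import Relation.Binary.PropositionalEquality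
open import Relation.Nullary using (yes; no; does; contradiction)
open import Relation.Unary using (Decidable)

private
  variable
    A B : Set

  module ∧ = CommutativeSemigroupProperties (CommutativeMonoid.commutativeSemigroup ∧-commutativeMonoid)
  module + = CommutativeSemigroupProperties +-commutativeSemigroup
  module * = CommutativeSemigroupProperties *-commutativeSemigroup

indicator : Bool → ℕ
indicator true  = 1
indicator false = 0

filterᵇ-cong : ∀ {p q : A → Bool} → (∀ x → p x ≡ q x) → ∀ xs → filterᵇ p xs ≡ filterᵇ q xs
filterᵇ-cong p≗q []       = refl
filterᵇ-cong {p = p} {q} p≗q (x ∷ xs) with p x | q x | p≗q x
... | true  | true  | refl = cong (x ∷_) (filterᵇ-cong p≗q xs)
... | false | false | refl = filterᵇ-cong p≗q xs

filterᵇ-filter : ∀ (p : A → Bool) {Q : A → Set} (Q? : Decidable Q) xs →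
  filterᵇ p (filter Q? xs) ≡ filterᵇ (λ x → does (Q? x) ∧ p x) xs
filterᵇ-filter p Q? [] = refl
filterᵇ-filter p Q? (x ∷ xs) with does (Q? x)
... | false = filterᵇ-filter p Q? xs
... | true with p x
...   | true  = cong (x ∷_) (filterᵇ-filter p Q? xs)
...   | false = filterᵇ-filter p Q? xs

filterᵇ-filterᵇ : ∀ (p q : A → Bool) xs → filterᵇ p (filterᵇ q xs) ≡ filterᵇ (λ x → q x ∧ p x) xs
filterᵇ-filterᵇ p q = filterᵇ-filter p (T? ∘ q)

filterᵇ-comm : ∀ (p q : A → Bool) xs → filterᵇ p (filterᵇ q xs) ≡ filterᵇ q (filterᵇ p xs)
filterᵇ-comm p q xs = begin
  filterᵇ p (filterᵇ q xs)          ≡⟨ filterᵇ-filterᵇ p q xs ⟩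
  filterᵇ (λ x → q x ∧ p x) xs      ≡⟨ filterᵇ-cong (λ x → ∧-comm (q x) (p x)) xs ⟩
  filterᵇ (λ x → p x ∧ q x) xs      ≡⟨ filterᵇ-filterᵇ q p xs ⟨
  filterᵇ q (filterᵇ p xs)          ∎
  where open ≡-Reasoning

filterᵇ-map : ∀ (p : B → Bool) (f : A → B) xs → filterᵇ p (map f xs) ≡ map f (filterᵇ (p ∘ f) xs)
filterᵇ-map p f [] = refl
filterᵇ-map p f (x ∷ xs) with p (f x)
... | true  = cong (f x ∷_) (filterᵇ-map p f xs)
... | false = filterᵇ-map p f xs

length-filterᵇ-∷ : ∀ (p : A → Bool) x xs →
  length (filterᵇ p (x ∷ xs)) ≡ indicator (p x) + length (filterᵇ p xs)
length-filterᵇ-∷ p x xs with p x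
... | true  = refl
... | false = refl

length-filterᵇ-concatMap : ∀ (p : B → Bool) (f : A → List B) xs →
  length (filterᵇ p (concatMap f xs)) ≡ sum (map (length ∘ filterᵇ p ∘ f) xs)
length-filterᵇ-concatMap p f []       = refl
length-filterᵇ-concatMap p f (x ∷ xs) = begin
  length (filterᵇ p (f x ++ concatMap f xs))
    ≡⟨ cong length (filter-++ (T? ∘ p) (f x) (concatMap f xs)) ⟩
  length (filterᵇ p (f x) ++ filterᵇ p (concatMap f xs))
    ≡⟨ length-++ (filterᵇ p (f x)) ⟩
  length (filterᵇ p (f x)) + length (filterᵇ p (concatMap f xs))
    ≡⟨ cong (length (filterᵇ p (f x)) +_) (length-filterᵇ-concatMap p f xs) ⟩
  sum (map (length ∘ filterᵇ p ∘ f) (x ∷ xs)) ∎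
  where open ≡-Reasoning

sum-map-++ : ∀ (f : A → ℕ) xs ys → sum (map f (xs ++ ys)) ≡ sum (map f xs) + sum (map f ys)
sum-map-++ f xs ys = trans (cong sum (map-++ f xs ys)) (sum-++ (map f xs) (map f ys))

sum-map-+ : ∀ (f g : A → ℕ) xs → sum (map (λ x → f x + g x) xs) ≡ sum (map f xs) + sum (map g xs)
sum-map-+ f g []       = refl
sum-map-+ f g (x ∷ xs) =
  trans (cong (f x + g x +_) (sum-map-+ f g xs)) (+.interchange (f x) (g x) (sum (map f xs)) (sum (map g xs)))

sum-map-indicator : ∀ (p : A → Bool) xs → sum (map (indicator ∘ p) xs) ≡ length (filterᵇ p xs)
sum-map-indicator p []       = refl
sum-map-indicator p (x ∷ xs) =
  trans (cong (indicator (p x) +_) (sum-map-indicator p xs)) (sym (length-filterᵇ-∷ p x xs))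

sum-map-≤ : ∀ {f : A → ℕ} {c xs} → All (λ x → f x ≤ c) xs → sum (map f xs) ≤ length xs * c
sum-map-≤ []           = z≤n
sum-map-≤ (fx≤c ∷ f≤c) = +-mono-≤ fx≤c (sum-map-≤ f≤c)

sum-map-const : ∀ {f : A → ℕ} {c xs} → All (λ x → f x ≡ c) xs → sum (map f xs) ≡ length xs * c
sum-map-const []           = refl
sum-map-const (fx≡c ∷ f≡c) = cong₂ _+_ fx≡c (sum-map-const f≡c)

allB-cong : ∀ {p q : A → Bool} → (∀ x → p x ≡ q x) → ∀ xs → allB p xs ≡ allB q xs
allB-cong p≗q []       = refl
allB-cong p≗q (x ∷ xs) = cong₂ _∧_ (p≗q x) (allB-cong p≗q xs)

allB-∧ : ∀ (p q : A → Bool) xs → allB (λ x → p x ∧ q x) xs ≡ allB p xs ∧ allB q xs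
allB-∧ p q []       = refl
allB-∧ p q (x ∷ xs) =
  trans (cong ((p x ∧ q x) ∧_) (allB-∧ p q xs)) (∧.interchange (p x) (q x) (allB p xs) (allB q xs))

choose-sized : ∀ {P : A → Set} k xs → All P xs → All (λ M → length M ≡ k × All P M) (choose k xs)
choose-sized zero    xs       _          = (refl , []) ∷ []
choose-sized (suc k) []       _          = []
choose-sized (suc k) (x ∷ xs) (px ∷ pxs) =
  AllP.++⁺ (AllP.map⁺ (All.map (λ { (refl , pM) → refl , px ∷ pM }) (choose-sized k xs pxs)))
           (choose-sized (suc k) xs pxs)

filterᵇ-allB-choose-∷ : ∀ (p : A → Bool) k x xs →
  filterᵇ (allB p) (choose (suc k) (x ∷ xs))
    ≡ map (x ∷_) (filterᵇ (λ M → p x ∧ allB p M) (choose k xs)) ++ filterᵇ (allB p) (choose (suc k) xs)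
filterᵇ-allB-choose-∷ p k x xs =
  trans (filter-++ (T? ∘ allB p) (map (x ∷_) (choose k xs)) (choose (suc k) xs))
        (cong (_++ filterᵇ (allB p) (choose (suc k) xs)) (filterᵇ-map (allB p) (x ∷_) (choose k xs)))

choose-filterᵇ : ∀ (p : A → Bool) k xs → filterᵇ (allB p) (choose k xs) ≡ choose k (filterᵇ p xs)
choose-filterᵇ p zero    xs       = refl
choose-filterᵇ p (suc k) []       = refl
choose-filterᵇ p (suc k) (x ∷ xs) with p x in px
... | true  = trans (filterᵇ-allB-choose-∷ p k x xs) (cong₂ (λ Ms Ns → map (x ∷_) Ms ++ Ns)
                (trans (filterᵇ-cong (λ M → cong (_∧ allB p M) px) (choose k xs)) (choose-filterᵇ p k xs))
                (choose-filterᵇ p (suc k) xs))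
... | false = trans (filterᵇ-allB-choose-∷ p k x xs) (cong₂ (λ Ms Ns → map (x ∷_) Ms ++ Ns)
                (trans (filterᵇ-cong (λ M → cong (_∧ allB p M) px) (choose k xs))
                       (filter-none (T? ∘ λ _ → false) (All.universal (λ _ ()) (choose k xs))))
                (choose-filterᵇ p (suc k) xs))

module Cliques {A : Set} (_#_ : A → A → Bool)
               (#-sym : ∀ x y → x # y ≡ y # x) (#-irrefl : ∀ x → x # x ≡ false) where

  compatible : List A → A → Bool
  compatible M y = allB (y #_) M

  neighbours : A → List A → List A
  neighbours x = filterᵇ (x #_)

  isClique : List A → Bool
  isClique []       = true
  isClique (x ∷ xs) = compatible xs x ∧ isClique xs

  cliques : ℕ → List A → List (List A)
  cliques k xs = filterᵇ isClique (choose k xs)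

  extensions : List A → List A → List A
  extensions ys M = filterᵇ (compatible M) ys

  extensionCount : ℕ → List A → List A → ℕ
  extensionCount k xs ys = sum (map (length ∘ extensions ys) (cliques k xs))

  neighbours-self : ∀ x xs → neighbours x (x ∷ xs) ≡ neighbours x xs
  neighbours-self x xs = filter-reject (T? ∘ (x #_)) (subst T (#-irrefl x))

  cliques-∷ : ∀ k x xs →
    cliques (suc k) (x ∷ xs) ≡ map (x ∷_) (cliques k (neighbours x xs)) ++ cliques (suc k) xs
  cliques-∷ k x xs = begin
    filterᵇ isClique (map (x ∷_) (choose k xs) ++ choose (suc k) xs)
      ≡⟨ filter-++ (T? ∘ isClique) (map (x ∷_) (choose k xs)) (choose (suc k) xs) ⟩
    filterᵇ isClique (map (x ∷_) (choose k xs)) ++ cliques (suc k) xs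
      ≡⟨ cong (_++ cliques (suc k) xs) (filterᵇ-map isClique (x ∷_) (choose k xs)) ⟩
    map (x ∷_) (filterᵇ (λ M → compatible M x ∧ isClique M) (choose k xs)) ++ cliques (suc k) xs
      ≡⟨ cong (λ Ms → map (x ∷_) Ms ++ cliques (suc k) xs) (begin
           filterᵇ (λ M → compatible M x ∧ isClique M) (choose k xs)
             ≡⟨ filterᵇ-filterᵇ isClique (λ M → compatible M x) (choose k xs) ⟨
           filterᵇ isClique (filterᵇ (allB (x #_)) (choose k xs))
             ≡⟨ cong (filterᵇ isClique) (choose-filterᵇ (x #_) k xs) ⟩
           cliques k (neighbours x xs) ∎) ⟩
    map (x ∷_) (cliques k (neighbours x xs)) ++ cliques (suc k) xs ∎
    where open ≡-Reasoning

  length-cliques-∷ : ∀ k x xs →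
    length (cliques (suc k) (x ∷ xs)) ≡ length (cliques k (neighbours x xs)) + length (cliques (suc k) xs)
  length-cliques-∷ k x xs = begin
    length (cliques (suc k) (x ∷ xs))
      ≡⟨ cong length (cliques-∷ k x xs) ⟩
    length (map (x ∷_) (cliques k (neighbours x xs)) ++ cliques (suc k) xs)
      ≡⟨ length-++ (map (x ∷_) (cliques k (neighbours x xs))) ⟩
    length (map (x ∷_) (cliques k (neighbours x xs))) + length (cliques (suc k) xs)
      ≡⟨ cong (_+ length (cliques (suc k) xs)) (length-map (x ∷_) (cliques k (neighbours x xs))) ⟩
    length (cliques k (neighbours x xs)) + length (cliques (suc k) xs) ∎
    where open ≡-Reasoning

  length-cliques-one : ∀ xs → length (cliques 1 xs) ≡ length xs
  length-cliques-one []       = refl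
  length-cliques-one (x ∷ xs) = trans (length-cliques-∷ 0 x xs) (cong suc (length-cliques-one xs))

  extensions-∷ : ∀ ys x M → extensions ys (x ∷ M) ≡ extensions (neighbours x ys) M
  extensions-∷ ys x M = begin
    filterᵇ (λ y → (y # x) ∧ compatible M y) ys
      ≡⟨ filterᵇ-cong (λ y → cong (_∧ compatible M y) (#-sym y x)) ys ⟩
    filterᵇ (λ y → (x # y) ∧ compatible M y) ys
      ≡⟨ filterᵇ-filterᵇ (compatible M) (x #_) ys ⟨
    filterᵇ (compatible M) (neighbours x ys) ∎
    where open ≡-Reasoning

  extensionCount-zero : ∀ xs ys → extensionCount 0 xs ys ≡ length ys
  extensionCount-zero xs ys =
    trans (+-identityʳ _) (cong length (filter-all (T? ∘ λ _ → true) (All.universal _ ys)))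

  extensionCount-∷ˡ : ∀ k x xs ys →
    extensionCount (suc k) (x ∷ xs) ys
      ≡ extensionCount k (neighbours x xs) (neighbours x ys) + extensionCount (suc k) xs ys
  extensionCount-∷ˡ k x xs ys = begin
    sum (map (length ∘ extensions ys) (cliques (suc k) (x ∷ xs)))
      ≡⟨ cong (sum ∘ map (length ∘ extensions ys)) (cliques-∷ k x xs) ⟩
    sum (map (length ∘ extensions ys) (map (x ∷_) Ms ++ cliques (suc k) xs))
      ≡⟨ sum-map-++ (length ∘ extensions ys) (map (x ∷_) Ms) (cliques (suc k) xs) ⟩
    sum (map (length ∘ extensions ys) (map (x ∷_) Ms)) + extensionCount (suc k) xs ys
      ≡⟨ cong (λ s → sum s + extensionCount (suc k) xs ys) (begin
           map (length ∘ extensions ys) (map (x ∷_) Ms)           ≡⟨ map-∘ Ms ⟨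
           map (λ M → length (extensions ys (x ∷ M))) Ms           ≡⟨ map-cong (cong length ∘ extensions-∷ ys x) Ms ⟩
           map (length ∘ extensions (neighbours x ys)) Ms         ∎) ⟩
    extensionCount k (neighbours x xs) (neighbours x ys) + extensionCount (suc k) xs ys ∎
    where
    open ≡-Reasoning
    Ms = cliques k (neighbours x xs)

  extensionCount-∷ʳ : ∀ k xs y ys →
    extensionCount k xs (y ∷ ys) ≡ length (cliques k (neighbours y xs)) + extensionCount k xs ys
  extensionCount-∷ʳ k xs y ys = begin
    sum (map (length ∘ extensions (y ∷ ys)) (cliques k xs))
      ≡⟨ cong sum (map-cong (λ M → length-filterᵇ-∷ (compatible M) y ys) (cliques k xs)) ⟩
    sum (map (λ M → indicator (compatible M y) + length (extensions ys M)) (cliques k xs))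
      ≡⟨ sum-map-+ (λ M → indicator (compatible M y)) (length ∘ extensions ys) (cliques k xs) ⟩
    sum (map (λ M → indicator (compatible M y)) (cliques k xs)) + extensionCount k xs ys
      ≡⟨ cong (_+ extensionCount k xs ys) (begin
           sum (map (λ M → indicator (compatible M y)) (cliques k xs))
             ≡⟨ sum-map-indicator (λ M → compatible M y) (cliques k xs) ⟩
           length (filterᵇ (allB (y #_)) (filterᵇ isClique (choose k xs)))
             ≡⟨ cong length (filterᵇ-comm (allB (y #_)) isClique (choose k xs)) ⟩
           length (filterᵇ isClique (filterᵇ (allB (y #_)) (choose k xs)))
             ≡⟨ cong (length ∘ filterᵇ isClique) (choose-filterᵇ (y #_) k xs) ⟩
           length (cliques k (neighbours y xs)) ∎) ⟩
    length (cliques k (neighbours y xs)) + extensionCount k xs ys ∎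
    where open ≡-Reasoning

  extensionCount-self : ∀ k xs → extensionCount k xs xs ≡ suc k * length (cliques (suc k) xs)
  extensionCount-self zero    xs       =
    trans (extensionCount-zero xs xs) (sym (trans (+-identityʳ _) (length-cliques-one xs)))
  extensionCount-self (suc k) []       = sym (*-zeroʳ (suc (suc k)))
  extensionCount-self (suc k) (x ∷ xs) = begin
    extensionCount (suc k) (x ∷ xs) (x ∷ xs)
      ≡⟨ extensionCount-∷ˡ k x xs (x ∷ xs) ⟩
    extensionCount k xs′ (neighbours x (x ∷ xs)) + extensionCount (suc k) xs (x ∷ xs)
      ≡⟨ cong₂ _+_ (cong (extensionCount k xs′) (neighbours-self x xs)) (extensionCount-∷ʳ (suc k) xs x xs) ⟩
    extensionCount k xs′ xs′ + (a + extensionCount (suc k) xs xs)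
      ≡⟨ cong₂ (λ u v → u + (a + v)) (extensionCount-self k xs′) (extensionCount-self (suc k) xs) ⟩
    suc k * a + (a + suc (suc k) * b)
      ≡⟨ regroup k a b ⟩
    suc (suc k) * (a + b)
      ≡⟨ cong (suc (suc k) *_) (length-cliques-∷ (suc k) x xs) ⟨
    suc (suc k) * length (cliques (suc (suc k)) (x ∷ xs)) ∎
    where
    open ≡-Reasoning
    xs′ = neighbours x xs
    a = length (cliques (suc k) xs′)
    b = length (cliques (suc (suc k)) xs)
    regroup : ∀ k a b → suc k * a + (a + suc (suc k) * b) ≡ suc (suc k) * (a + b)
    regroup = solve-∀

sumᶠ : ∀ {n} → (Fin n → ℕ) → ℕ
sumᶠ {zero}  f = 0
sumᶠ {suc n} f = f fzero + sumᶠ (f ∘ fsuc)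

countᶠ : ∀ {n} → (Fin n → Bool) → ℕ
countᶠ s = sumᶠ (indicator ∘ s)

sumᶠ-cong : ∀ {n} {f g : Fin n → ℕ} → (∀ i → f i ≡ g i) → sumᶠ f ≡ sumᶠ g
sumᶠ-cong {zero}  f≗g = refl
sumᶠ-cong {suc n} f≗g = cong₂ _+_ (f≗g fzero) (sumᶠ-cong (f≗g ∘ fsuc))

countᶠ-false : ∀ n → countᶠ {n} (λ _ → false) ≡ 0
countᶠ-false zero    = refl
countᶠ-false (suc n) = countᶠ-false n

countᶠ-true : ∀ n → countᶠ {n} (λ _ → true) ≡ n
countᶠ-true zero    = refl
countᶠ-true (suc n) = cong suc (countᶠ-true n)

sum-map-tabulate : ∀ {n} (f : A → ℕ) (g : Fin n → A) → sum (map f (tabulate g)) ≡ sumᶠ (f ∘ g)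
sum-map-tabulate {n = zero}  f g = refl
sum-map-tabulate {n = suc n} f g = cong (f (g fzero) +_) (sum-map-tabulate f (g ∘ fsuc))

length-filterᵇ-tabulate : ∀ {n} (p : A → Bool) (g : Fin n → A) →
  length (filterᵇ p (tabulate g)) ≡ countᶠ (p ∘ g)
length-filterᵇ-tabulate p g = trans (sym (sum-map-indicator p (tabulate g))) (sum-map-tabulate (indicator ∘ p) g)

suc-C-2 : ∀ c → suc c C 2 ≡ c + c C 2
suc-C-2 c = trans (sym (nCk+nC[k+1]≡[n+1]C[k+1] c 1)) (cong (_+ c C 2) (nC1≡n c))

countᶠ-pairs : ∀ {n} (s : Fin n → Bool) →
  sumᶠ (λ i → countᶠ (λ j → (toℕ i <ᵇ toℕ j) ∧ (s i ∧ s j))) ≡ countᶠ s C 2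
countᶠ-pairs {zero}  s = refl
countᶠ-pairs {suc n} s with s fzero | countᶠ-pairs (s ∘ fsuc)
... | true  | ih = trans (cong (countᶠ (s ∘ fsuc) +_) ih) (sym (suc-C-2 (countᶠ (s ∘ fsuc))))
... | false | ih = cong₂ _+_ (countᶠ-false n) ih

eqF-refl : ∀ {n} (a : Fin n) → eqF a a ≡ true
eqF-refl a with a ≟ᶠ a
... | yes _   = refl
... | no a≢a = contradiction refl a≢a

eqF-sym : ∀ {n} (a b : Fin n) → eqF a b ≡ eqF b a
eqF-sym a b with a ≟ᶠ b
... | yes refl = sym (eqF-refl a)
... | no a≢b with b ≟ᶠ a
...   | yes refl = contradiction refl a≢b
...   | no _     = refl

eqF-suc : ∀ {n} (v a : Fin n) → eqF (fsuc v) (fsuc a) ≡ eqF v a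
eqF-suc v a with v ≟ᶠ a
... | yes _ = refl
... | no _  = refl

countᶠ-remove : ∀ {n} (s : Fin n → Bool) a → T (s a) →
  suc (countᶠ (λ v → not (eqF v a) ∧ s v)) ≡ countᶠ s
countᶠ-remove s fzero    sa with s fzero
... | true = refl
countᶠ-remove s (fsuc a) sa = begin
  suc (indicator (s fzero) + countᶠ (λ v → not (eqF (fsuc v) (fsuc a)) ∧ s (fsuc v)))
    ≡⟨ +-suc (indicator (s fzero)) _ ⟨
  indicator (s fzero) + suc (countᶠ (λ v → not (eqF (fsuc v) (fsuc a)) ∧ s (fsuc v)))
    ≡⟨ cong (λ c → indicator (s fzero) + suc c)
            (sumᶠ-cong (λ v → cong (λ b → indicator (not b ∧ s (fsuc v))) (eqF-suc v a))) ⟩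
  indicator (s fzero) + suc (countᶠ (λ v → not (eqF v a) ∧ s (fsuc v)))
    ≡⟨ cong (indicator (s fzero) +_) (countᶠ-remove (s ∘ fsuc) a sa) ⟩
  countᶠ s ∎
  where open ≡-Reasoning

disjointE-sym : ∀ {n} (e f : Edge n) → disjointE e f ≡ disjointE f e
disjointE-sym (a , b) (c , d)
  rewrite eqF-sym c a | eqF-sym c b | eqF-sym d a | eqF-sym d b =
  cong (not (eqF a c) ∧_) (∧.x∙yz≈y∙xz (not (eqF a d)) (not (eqF b c)) (not (eqF b d)))

disjointE-irrefl : ∀ {n} (e : Edge n) → disjointE e e ≡ false
disjointE-irrefl (a , b) rewrite eqF-refl a = refl

module Matchings {n : ℕ} = Cliques (disjointE {n}) disjointE-sym disjointE-irrefl
open Matchings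

isClique≗pairwiseDisjoint : ∀ {n} (M : List (Edge n)) → isClique M ≡ pairwiseDisjoint M
isClique≗pairwiseDisjoint []      = refl
isClique≗pairwiseDisjoint (e ∷ M) = cong (allB (disjointE e) M ∧_) (isClique≗pairwiseDisjoint M)

graphEdges : ∀ {n} → Graph n → List (Edge n)
graphEdges G = filterᵇ (adjE G) (edges G)

m≡length-cliques : ∀ {n} (G : Graph n) k → m G k ≡ length (cliques k (graphEdges G))
m≡length-cliques G k = cong length (filterᵇ-cong (sym ∘ isClique≗pairwiseDisjoint) (choose k (graphEdges G)))

NonLoop : ∀ {n} → Edge n → Set
NonLoop (i , j) = eqF i j ≡ false

edges-nonLoop : ∀ n → All NonLoop (edges (K n))
edges-nonLoop n = AllP.concat⁺ (AllP.map⁺ (All.universal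
  (λ i → AllP.map⁺ (All.map (<⇒nonLoop i) (AllP.all-filter (λ j → toℕ i <? toℕ j) (allFin n))))
  (allFin n)))
  where
  <⇒nonLoop : ∀ i {j} → toℕ i < toℕ j → eqF i j ≡ false
  <⇒nonLoop i {j} i<j with i ≟ᶠ j
  ... | yes refl = contradiction i<j (<-irrefl refl)
  ... | no _     = refl

graphEdges-complete : ∀ n → graphEdges (K n) ≡ edges (K n)
graphEdges-complete n = filter-all (T? ∘ adjE (K n)) (All.map adjacent (edges-nonLoop n))
  where
  adjacent : ∀ {e} → NonLoop e → T (adjE (K n) e)
  adjacent {i , j} i≢j rewrite i≢j = _

length-filterᵇ-edges : ∀ {n} (p : Fin n → Fin n → Bool) →
  length (filterᵇ (uncurry p) (edges (K n))) ≡ sumᶠ (λ i → countᶠ (λ j → (toℕ i <ᵇ toℕ j) ∧ p i j))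
length-filterᵇ-edges {n} p = begin
  length (filterᵇ (uncurry p) (concatMap row (allFin n)))
    ≡⟨ length-filterᵇ-concatMap (uncurry p) row (allFin n) ⟩
  sum (map (length ∘ filterᵇ (uncurry p) ∘ row) (allFin n))
    ≡⟨ sum-map-tabulate (length ∘ filterᵇ (uncurry p) ∘ row) id ⟩
  sumᶠ (length ∘ filterᵇ (uncurry p) ∘ row)
    ≡⟨ sumᶠ-cong length-row ⟩
  sumᶠ (λ i → countᶠ (λ j → (toℕ i <ᵇ toℕ j) ∧ p i j)) ∎
  where
  open ≡-Reasoning
  row : Fin n → List (Edge n)
  row i = map (i ,_) (filter (λ j → toℕ i <? toℕ j) (allFin n))
  length-row : ∀ i → length (filterᵇ (uncurry p) (row i)) ≡ countᶠ (λ j → (toℕ i <ᵇ toℕ j) ∧ p i j)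
  length-row i = begin
    length (filterᵇ (uncurry p) (map (i ,_) above))
      ≡⟨ cong length (filterᵇ-map (uncurry p) (i ,_) above) ⟩
    length (map (i ,_) (filterᵇ (p i) above))
      ≡⟨ length-map (i ,_) (filterᵇ (p i) above) ⟩
    length (filterᵇ (p i) above)
      ≡⟨ cong length (filterᵇ-filter (p i) (λ j → toℕ i <? toℕ j) (allFin n)) ⟩
    length (filterᵇ (λ j → (toℕ i <ᵇ toℕ j) ∧ p i j) (allFin n))
      ≡⟨ length-filterᵇ-tabulate (λ j → (toℕ i <ᵇ toℕ j) ∧ p i j) id ⟩
    countᶠ (λ j → (toℕ i <ᵇ toℕ j) ∧ p i j) ∎
    where above = filter (λ j → toℕ i <? toℕ j) (allFin n)

avoids : ∀ {n} → Edge n → Fin n → Bool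
avoids (a , b) v = not (eqF v a) ∧ not (eqF v b)

uncovered : ∀ {n} → List (Edge n) → Fin n → Bool
uncovered M v = allB (λ e → avoids e v) M

compatible-uncovered : ∀ {n} (M : List (Edge n)) i j → compatible M (i , j) ≡ uncovered M i ∧ uncovered M j
compatible-uncovered M i j =
  trans (allB-cong (λ { (a , b) → sym (∧-assoc (not (eqF i a)) (not (eqF i b)) _) }) M)
        (allB-∧ (λ e → avoids e i) (λ e → avoids e j) M)

uncovered-count : ∀ {n} (M : List (Edge n)) → All NonLoop M → T (isClique M) →
  countᶠ (uncovered M) + (length M + length M) ≡ n
uncovered-count {n} []            []                     _      = trans (+-identityʳ _) (countᶠ-true n)
uncovered-count {n} ((a , b) ∷ M) (a≢b ∷ nonLoop) clique = begin
  countᶠ (uncovered ((a , b) ∷ M)) + (suc l + suc l)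
    ≡⟨ shift (countᶠ (uncovered ((a , b) ∷ M))) l ⟩
  suc (suc (countᶠ (uncovered ((a , b) ∷ M)))) + (l + l)
    ≡⟨ cong (λ c → suc (suc c) + (l + l))
            (sumᶠ-cong (λ v → cong indicator (∧-assoc (not (eqF v a)) (not (eqF v b)) (u v)))) ⟩
  suc (suc (countᶠ (λ v → not (eqF v a) ∧ (not (eqF v b) ∧ u v)))) + (l + l)
    ≡⟨ cong (λ c → suc c + (l + l)) (countᶠ-remove (λ v → not (eqF v b) ∧ u v) a a-free) ⟩
  suc (countᶠ (λ v → not (eqF v b) ∧ u v)) + (l + l)
    ≡⟨ cong (_+ (l + l)) (countᶠ-remove u b (proj₂ ends-free)) ⟩
  countᶠ u + (l + l)
    ≡⟨ uncovered-count M nonLoop (proj₂ clique-parts) ⟩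
  n ∎
  where
  open ≡-Reasoning
  u = uncovered M
  l = length M
  shift : ∀ c l → c + (suc l + suc l) ≡ suc (suc c) + (l + l)
  shift = solve-∀
  clique-parts : T (compatible M (a , b)) × T (isClique M)
  clique-parts = Equivalence.to T-∧ clique
  ends-free : T (u a) × T (u b)
  ends-free = Equivalence.to T-∧ (subst T (compatible-uncovered M a b) (proj₁ clique-parts))
  a-free : T (not (eqF a b) ∧ u a)
  a-free rewrite a≢b = proj₁ ends-free

IsMatching : ∀ {n} → ℕ → List (Edge n) → Set
IsMatching k M = (length M ≡ k × All NonLoop M) × T (isClique M)

cliques-isMatching : ∀ {n} k (E : List (Edge n)) → All NonLoop E → All (IsMatching k) (cliques k E)
cliques-isMatching k E nonLoop =
  All.zip (AllP.filter⁺ (T? ∘ isClique) (choose-sized k E nonLoop) , AllP.all-filter (T? ∘ isClique) (choose k E))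

length-extensions-complete : ∀ {n} k (M : List (Edge n)) → IsMatching k M →
  length (extensions (edges (K n)) M) ≡ (n ∸ (k + k)) C 2
length-extensions-complete {n} k M ((refl , nonLoop) , clique) = begin
  length (filterᵇ (compatible M) (edges (K n)))
    ≡⟨ cong length (filterᵇ-cong (λ { (i , j) → compatible-uncovered M i j }) (edges (K n))) ⟩
  length (filterᵇ (uncurry (λ i j → uncovered M i ∧ uncovered M j)) (edges (K n)))
    ≡⟨ length-filterᵇ-edges (λ i j → uncovered M i ∧ uncovered M j) ⟩
  sumᶠ (λ i → countᶠ (λ j → (toℕ i <ᵇ toℕ j) ∧ (uncovered M i ∧ uncovered M j)))
    ≡⟨ countᶠ-pairs (uncovered M) ⟩
  countᶠ (uncovered M) C 2
    ≡⟨ cong (λ c → c C 2) (m+n∸n≡m (countᶠ (uncovered M)) (k + k)) ⟨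
  (countᶠ (uncovered M) + (k + k) ∸ (k + k)) C 2
    ≡⟨ cong (λ c → (c ∸ (k + k)) C 2) (uncovered-count M nonLoop clique) ⟩
  (n ∸ (k + k)) C 2 ∎
  where open ≡-Reasoning

length-extensions-≤-complete : ∀ {n} (G : Graph n) M →
  length (extensions (graphEdges G) M) ≤ length (extensions (edges (K n)) M)
length-extensions-≤-complete {n} G M = begin
  length (filterᵇ (compatible M) (filterᵇ (adjE G) (edges G)))
    ≡⟨ cong length (filterᵇ-comm (compatible M) (adjE G) (edges G)) ⟩
  length (filterᵇ (adjE G) (filterᵇ (compatible M) (edges G)))
    ≤⟨ length-filter (T? ∘ adjE G) (filterᵇ (compatible M) (edges G)) ⟩
  length (filterᵇ (compatible M) (edges (K n))) ∎
  where open ≤-Reasoning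

matchings-suc-≤ : ∀ {n} (G : Graph n) k → suc k * m G (suc k) ≤ m G k * ((n ∸ (k + k)) C 2)
matchings-suc-≤ {n} G k = begin
  suc k * m G (suc k)                      ≡⟨ cong (suc k *_) (m≡length-cliques G (suc k)) ⟩
  suc k * length (cliques (suc k) E)       ≡⟨ extensionCount-self k E ⟨
  extensionCount k E E                     ≤⟨ sum-map-≤ (All.map bound (cliques-isMatching k E nonLoop)) ⟩
  length (cliques k E) * ((n ∸ (k + k)) C 2) ≡⟨ cong (_* ((n ∸ (k + k)) C 2)) (m≡length-cliques G k) ⟨
  m G k * ((n ∸ (k + k)) C 2)              ∎
  where
  open ≤-Reasoning
  E = graphEdges G
  nonLoop : All NonLoop E
  nonLoop = AllP.filter⁺ (T? ∘ adjE G) (edges-nonLoop n)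
  bound : ∀ {M} → IsMatching k M → length (extensions E M) ≤ (n ∸ (k + k)) C 2
  bound {M} isM = ≤-trans (length-extensions-≤-complete G M) (≤-reflexive (length-extensions-complete k M isM))

matchings-suc-complete : ∀ n k → suc k * m (K n) (suc k) ≡ m (K n) k * ((n ∸ (k + k)) C 2)
matchings-suc-complete n k = begin
  suc k * m (K n) (suc k)                  ≡⟨ cong (suc k *_) (m≡length-cliques (K n) (suc k)) ⟩
  suc k * length (cliques (suc k) E)       ≡⟨ extensionCount-self k E ⟨
  extensionCount k E E                     ≡⟨ sum-map-const (All.map exact (cliques-isMatching k E nonLoop)) ⟩
  length (cliques k E) * ((n ∸ (k + k)) C 2) ≡⟨ cong (_* ((n ∸ (k + k)) C 2)) (m≡length-cliques (K n) k) ⟨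
  m (K n) k * ((n ∸ (k + k)) C 2)          ∎
  where
  open ≡-Reasoning
  E = graphEdges (K n)
  nonLoop : All NonLoop E
  nonLoop = subst (All NonLoop) (sym (graphEdges-complete n)) (edges-nonLoop n)
  exact : ∀ {M} → IsMatching k M → length (extensions E M) ≡ (n ∸ (k + k)) C 2
  exact {M} isM = trans (cong (λ E′ → length (extensions E′ M)) (graphEdges-complete n))
                        (length-extensions-complete k M isM)

cross-multiply : ∀ k a b c d {e} → suc k * b ≤ a * e → suc k * d ≡ c * e → c * b ≤ a * d
cross-multiply k a b c d {e} kb≤ae kd≡ce = *-cancelˡ-≤ (suc k) (begin
  suc k * (c * b)   ≡⟨ *.x∙yz≈y∙xz (suc k) c b ⟩
  c * (suc k * b)   ≤⟨ *-monoʳ-≤ c kb≤ae ⟩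
  c * (a * e)       ≡⟨ *.x∙yz≈y∙xz c a e ⟩
  a * (c * e)       ≡⟨ cong (a *_) kd≡ce ⟨
  a * (suc k * d)   ≡⟨ *.x∙yz≈y∙xz a (suc k) d ⟩
  suc k * (a * d)   ∎)
  where open ≤-Reasoning

-- The hypothesis k < μ G only makes the ratios of the informal statement well defined;
-- their cross-multiplied form holds for every k.
lemma3p5 : ∀ (n : ℕ) (G : Graph n) (k : ℕ) → k < μ G →
    m (K n) k * m G (suc k) ≤ m G k * m (K n) (suc k)
lemma3p5 n G k _ =
  cross-multiply k (m G k) (m G (suc k)) (m (K n) k) (m (K n) (suc k))
    (matchings-suc-≤ G k) (matchings-suc-complete n k)
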